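{- Let $s\in\mathbb N$, let $a_1,\ldots,a_s\geq 2$ be integers, and let $P_1,\ldots,P_s\in\mathcal P_{\mathbb N}$ satisfy $\sum_{i=1}^s\frac{1}{\deg(P_i)}<1$. Then the set $$A=\Big\{a_1^{P_1(n_1)}\cdots a_s^{P_s(n_s)} : n_1,\ldots,n_s\in\mathbb N_0\Big\}$$ is not complete.
   Context: $\mathbb N=\{1,2,\ldots\}$, $\mathbb N_0=\mathbb N\cup\{0\}$. $\mathcal P_{\mathbb N}$ is the set of nonconstant polynomials $P$ with $P(\mathbb N_0)\subseteq\mathbb N_0$ and $P(0)=0$. $\mathrm{FS}(A)=\{\sum_{n\in F}n : \emptyset\neq F\subseteq A \text{ finite}\}$; $A\subseteq\mathbb N$ is complete if $\mathbb N\setminus\mathrm{FS}(A)$ is finite. -}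

module Defs where

open import Data.Nat as ℕ using (ℕ; zero; suc; _≤_; _≥_)
open import Data.Fin using (Fin; zero; suc)
import Data.Fin
open import Data.Integer using (+_)
open import Data.Rational as ℚ using (ℚ; 0ℚ; 1ℚ; _+_; _*_; _/_)
open import Data.List using (List; []; _∷_)
open import Data.Nat.ListAction using (sum)
open import Data.List.Relation.Unary.All using (All)
open import Data.List.Relation.Unary.Unique.Propositional using (Unique)
open import Data.Product using (Σ; _×_; ∃)
open import Relation.Binary.PropositionalEquality using (_≡_; _≢_)
open import Relation.Nullary using (¬_)

Σℚ : (n : ℕ) → (Fin n → ℚ) → ℚ
Σℚ zero    f = 0ℚ
Σℚ (suc n) f = f zero + Σℚ n (λ i → f (suc i))

Πℕ : (n : ℕ) → (Fin n → ℕ) → ℕ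
Πℕ zero    f = 1
Πℕ (suc n) f = f zero ℕ.* Πℕ n (λ i → f (suc i))

natℚ : ℕ → ℚ
natℚ n = + n / 1

powℚ : ℚ → ℕ → ℚ
powℚ x zero    = 1ℚ
powℚ x (suc k) = x * powℚ x k

-- A polynomial with rational coefficients of exact degree `deg`:
-- P(x) = Σ_{j=0}^{deg} coeff j * x^j, with nonzero leading coefficient.
-- (Polynomials mapping ℕ₀ to ℕ₀ necessarily have rational coefficients.)
record Poly : Set where
  field
    deg     : ℕ
    coeff   : Fin (suc deg) → ℚ
    leading : coeff (Data.Fin.fromℕ deg) ≢ 0ℚ

open Poly public

eval : Poly → ℕ → ℚ
eval P n = Σℚ (suc (deg P)) (λ j → coeff P j * powℚ (natℚ n) (Data.Fin.toℕ j))

record InPN (P : Poly) : Set where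
  field
    nonconst : 1 ≤ deg P
    natValued : (n : ℕ) → ∃ λ (m : ℕ) → eval P n ≡ natℚ m
    zeroAt0  : eval P 0 ≡ 0ℚ

-- 1 / d as a rational (only used for d ≥ 1; value at 0 is irrelevant).
inv : ℕ → ℚ
inv zero    = 0ℚ
inv (suc k) = + 1 / suc k

-- FS(A): sums of nonempty finite subsets of A (a finite subset is given
-- as a duplicate-free nonempty list of elements of A).
FS : (ℕ → Set) → ℕ → Set
FS A m = Σ (List ℕ) λ xs → (xs ≢ []) × Unique xs × All A xs × sum xs ≡ m

-- A ⊆ ℕ is complete if ℕ ∖ FS(A) is finite, i.e. FS(A) contains all
-- sufficiently large natural numbers.
Complete : (ℕ → Set) → Set
Complete A = ∃ λ (N : ℕ) → (m : ℕ) → m ≥ N → FS A m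

PowSet : (s : ℕ) → (Fin s → ℕ) → (Fin s → Poly) → ℕ → Set
PowSet s a P m =
  Σ (Fin s → ℕ) λ n → Σ (Fin s → ℕ) λ e →
    ((i : Fin s) → eval (P i) (n i) ≡ natℚ (e i)) ×
    m ≡ Πℕ s (λ i → a i ℕ.^ e i)

module Submission where

-- A set A ⊆ ℕ cannot be complete if it is sparse in the
-- following sense: for every N there is an X such that the elements of A
-- below X can be listed in a list L with N + 2^|L| < X.  Indeed, each of the
-- 2^|L| + 1 numbers N, …, N + 2^|L| would have to be a sum of distinct
-- elements of A, all below X, hence a subset sum of L; but L has only 2^|L|
-- subset sums (module SubsetSums).
--
-- For A = { ∏ aᵢ^{Pᵢ(nᵢ)} } put dᵢ = deg Pᵢ, D = ∏ dᵢ and qᵢ = D / dᵢ; the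
-- hypothesis Σ 1/dᵢ < 1 becomes Σ qᵢ < D (module DegreeBudget).  Every
-- polynomial of degree d ≥ 1 grows like xᵈ (module PolynomialGrowth), so
-- Pᵢ(n) < Mᴰ = (M^{qᵢ})^{dᵢ} forces n < Cᵢ · M^{qᵢ}.  An element of A below
-- 2^{Mᴰ} has all exponents Pᵢ(nᵢ) < Mᴰ, so it lies in an explicit grid of
-- ∏ Cᵢ M^{qᵢ} ≤ (∏ Cᵢ) · M^{D-1} products (module FiniteProducts), and for
-- M = N + 1 + ∏ Cᵢ this is small enough (module Room).

module SubsetSums where

  open import Data.Nat using (ℕ; suc; _+_; _^_; _≤_; _<_)
  import Data.Nat.Properties as ℕP
  open import Data.Nat.ListAction using (sum)
  open import Data.Nat.Solver using (module +-*-Solver)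
  open import Data.Fin using (Fin; toℕ)
  import Data.Fin.Properties as FP
  open import Data.List using (List; []; _∷_; _++_; map; length; filter; lookup)
  import Data.List.Properties as ListP
  open import Data.List.Membership.Propositional using (_∈_)
  open import Data.List.Membership.Propositional.Properties using (∈-map⁺; ∈-++⁺ˡ; ∈-++⁺ʳ; ∈-filter⁻)
  open import Data.List.Membership.DecPropositional ℕP._≟_ using (_∈?_)
  open import Data.List.Relation.Binary.Subset.Propositional using (_⊆_)
  open import Data.List.Relation.Unary.Any using (here; there; index)
  open import Data.List.Relation.Unary.Any.Properties using (lookup-index)
  open import Data.List.Relation.Unary.All as All using (All)
  open import Data.List.Relation.Unary.AllPairs using (_∷_)
  open import Data.List.Relation.Unary.Unique.Propositional using (Unique)
  import Data.List.Relation.Unary.Unique.Propositional.Properties as UniqueP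
  open import Data.Product using (∃; _×_; _,_)
  open import Function.Definitions using (Injective)
  open import Relation.Nullary using (¬_; ¬?; yes; no; contradiction)
  open import Relation.Binary.PropositionalEquality
  open import Defs using (Complete)

  -- Pigeonhole for lists: R distinct values all occurring in ys force R ≤ |ys|
  -- (their positions in ys are distinct).
  injective-members-≤-length : ∀ {R} (ys : List ℕ) (g : Fin R → ℕ) → Injective _≡_ _≡_ g →
                               (∀ i → g i ∈ ys) → R ≤ length ys
  injective-members-≤-length ys g g-inj g∈ys = FP.injective⇒≤ position-injective
    where
    position-injective : Injective _≡_ _≡_ (λ i → index (g∈ys i))
    position-injective {i} {j} same-position = g-inj (begin
      g i                        ≡⟨ lookup-index (g∈ys i) ⟩
      lookup ys (index (g∈ys i)) ≡⟨ cong (lookup ys) same-position ⟩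
      lookup ys (index (g∈ys j)) ≡⟨ lookup-index (g∈ys j) ⟨
      g j                        ∎)
      where open ≡-Reasoning

  subsetSums : List ℕ → List ℕ
  subsetSums []      = 0 ∷ []
  subsetSums (y ∷ L) = subsetSums L ++ map (y +_) (subsetSums L)

  length-subsetSums : ∀ L → length (subsetSums L) ≡ 2 ^ length L
  length-subsetSums []      = refl
  length-subsetSums (y ∷ L) = begin
    length (subsetSums L ++ map (y +_) (subsetSums L))         ≡⟨ ListP.length-++ (subsetSums L) ⟩
    length (subsetSums L) + length (map (y +_) (subsetSums L)) ≡⟨ cong (length (subsetSums L) +_)
                                                                       (ListP.length-map (y +_) (subsetSums L)) ⟩
    length (subsetSums L) + length (subsetSums L)              ≡⟨ cong (λ n → n + n) (length-subsetSums L) ⟩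
    2 ^ length L + 2 ^ length L                                ≡⟨ cong (2 ^ length L +_) (ℕP.+-identityʳ _) ⟨
    2 ^ length (y ∷ L)                                         ∎
    where open ≡-Reasoning

  without : ℕ → List ℕ → List ℕ
  without y = filter (λ x → ¬? (x ℕP.≟ y))

  sum-without : ∀ {y xs} → Unique xs → y ∈ xs → sum xs ≡ y + sum (without y xs)
  sum-without {y} {y ∷ xs} (y∉xs ∷ _) (here refl) = cong (y +_) (cong sum (begin
    xs                  ≡⟨ ListP.filter-all (λ x → ¬? (x ℕP.≟ y)) (All.map (λ y≢x x≡y → y≢x (sym x≡y)) y∉xs) ⟨
    without y xs        ≡⟨ ListP.filter-reject (λ x → ¬? (x ℕP.≟ y)) (λ y≢y → y≢y refl) ⟨
    without y (y ∷ xs)  ∎))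
    where open ≡-Reasoning
  sum-without {y} {x ∷ xs} (x∉xs ∷ unique) (there y∈xs) = begin
    x + sum xs                    ≡⟨ cong (x +_) (sum-without unique y∈xs) ⟩
    x + (y + sum (without y xs))  ≡⟨ solve 3 (λ x y s → x :+ (y :+ s) := y :+ (x :+ s)) refl x y _ ⟩
    y + (x + sum (without y xs))  ≡⟨ cong (λ zs → y + sum zs)
                                          (ListP.filter-accept (λ x → ¬? (x ℕP.≟ y)) (All.lookup x∉xs y∈xs)) ⟨
    y + sum (without y (x ∷ xs))  ∎
    where
    open ≡-Reasoning
    open +-*-Solver

  without-⊆ : ∀ {y xs L} → xs ⊆ y ∷ L → without y xs ⊆ L
  without-⊆ {y} xs⊆y∷L z∈ with ∈-filter⁻ (λ x → ¬? (x ℕP.≟ y)) z∈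
  ... | z∈xs , z≢y with xs⊆y∷L z∈xs
  ...   | here z≡y  = contradiction z≡y z≢y
  ...   | there z∈L = z∈L

  sum-∈-subsetSums : ∀ L {xs} → Unique xs → xs ⊆ L → sum xs ∈ subsetSums L
  sum-∈-subsetSums []      {[]}    _ _    = here refl
  sum-∈-subsetSums []      {x ∷ _} _ xs⊆L with xs⊆L (here refl)
  ... | ()
  sum-∈-subsetSums (y ∷ L) {xs}    unique xs⊆y∷L with y ∈? xs
  ... | no y∉xs = subst (_∈ subsetSums (y ∷ L)) sum-unchanged (∈-++⁺ˡ rest)
    where
    rest : sum (without y xs) ∈ subsetSums L
    rest = sum-∈-subsetSums L (UniqueP.filter⁺ _ unique) (without-⊆ xs⊆y∷L)
    sum-unchanged : sum (without y xs) ≡ sum xs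
    sum-unchanged = cong sum (ListP.filter-all _ (All.tabulate λ x∈xs x≡y → y∉xs (subst (_∈ xs) x≡y x∈xs)))
  ... | yes y∈xs = subst (_∈ subsetSums (y ∷ L)) (sym (sum-without unique y∈xs))
                         (∈-++⁺ʳ (subsetSums L) (∈-map⁺ (y +_) rest))
    where
    rest : sum (without y xs) ∈ subsetSums L
    rest = sum-∈-subsetSums L (UniqueP.filter⁺ _ unique) (without-⊆ xs⊆y∷L)

  ∈⇒≤sum : ∀ {x} xs → x ∈ xs → x ≤ sum xs
  ∈⇒≤sum (x ∷ xs) (here refl) = ℕP.m≤m+n x (sum xs)
  ∈⇒≤sum (y ∷ xs) (there x∈)  = ℕP.≤-trans (∈⇒≤sum xs x∈) (ℕP.m≤n+m (sum xs) y)

  -- Sparseness criterion: if for every N the elements of A below some X are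
  -- listed in L with N + 2^|L| < X, then A is not complete, because the
  -- 2^|L| + 1 numbers N, …, N + 2^|L| would all be subset sums of L.
  sparse⇒¬complete : (A : ℕ → Set) →
    (∀ N → ∃ λ X → ∃ λ L → N + 2 ^ length L < X × (∀ {x} → A x → x < X → x ∈ L)) →
    ¬ Complete A
  sparse⇒¬complete A sparse (N , complete) with sparse N
  ... | X , L , N+2ᴸ<X , cover = ℕP.<-irrefl refl (begin-strict
    2 ^ length L             <⟨ ℕP.n<1+n _ ⟩
    suc (2 ^ length L)       ≤⟨ injective-members-≤-length (subsetSums L) (λ i → N + toℕ i) shift-injective reachable ⟩
    length (subsetSums L)    ≡⟨ length-subsetSums L ⟩
    2 ^ length L             ∎)
    where
    open ℕP.≤-Reasoning
    shift-injective : Injective _≡_ _≡_ (λ (i : Fin (suc (2 ^ length L))) → N + toℕ i)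
    shift-injective eq = FP.toℕ-injective (ℕP.+-cancelˡ-≡ N _ _ eq)
    below-X : ∀ (i : Fin (suc (2 ^ length L))) → N + toℕ i < X
    below-X i = ℕP.≤-<-trans (ℕP.+-monoʳ-≤ N (FP.toℕ≤pred[n] i)) N+2ᴸ<X
    reachable : ∀ (i : Fin (suc (2 ^ length L))) → N + toℕ i ∈ subsetSums L
    reachable i with complete (N + toℕ i) (ℕP.m≤m+n N (toℕ i))
    ... | xs , _ , unique , xs⊆A , sum≡ = subst (_∈ subsetSums L) sum≡ (sum-∈-subsetSums L unique λ x∈xs →
          cover (All.lookup xs⊆A x∈xs) (ℕP.≤-<-trans (∈⇒≤sum xs x∈xs) (subst (_< X) (sym sum≡) (below-X i))))

module FiniteProducts where

  open import Data.Nat using (ℕ; zero; suc; z≤n; s≤s; _+_; _*_; _^_; _≤_; _<_; >-nonZero)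
  import Data.Nat.Properties as ℕP
  open import Data.Nat.Divisibility using (_∣_; m∣m*n; ∣n⇒∣m*n)
  open import Data.Nat.Solver using (module +-*-Solver)
  open import Data.Fin using (Fin)
  import Data.Fin as Fin
  open import Data.List using (List; []; _∷_; _++_; length; map; applyUpTo; cartesianProductWith)
  import Data.List.Properties as ListP
  open import Data.List.Membership.Propositional using (_∈_)
  open import Data.List.Membership.Propositional.Properties using (∈-applyUpTo⁺; ∈-cartesianProductWith⁺)
  open import Data.List.Relation.Unary.Any using (here)
  open import Relation.Binary.PropositionalEquality
  open import Defs using (Πℕ)

  Σℕ : (n : ℕ) → (Fin n → ℕ) → ℕ
  Σℕ zero    f = 0
  Σℕ (suc n) f = f Fin.zero + Σℕ n (λ i → f (Fin.suc i))

  Πℕ-cong : ∀ s {f g : Fin s → ℕ} → (∀ i → f i ≡ g i) → Πℕ s f ≡ Πℕ s g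
  Πℕ-cong zero    f≗g = refl
  Πℕ-cong (suc s) f≗g = cong₂ _*_ (f≗g Fin.zero) (Πℕ-cong s (λ i → f≗g (Fin.suc i)))

  Πℕ-positive : ∀ s (f : Fin s → ℕ) → (∀ i → 1 ≤ f i) → 1 ≤ Πℕ s f
  Πℕ-positive zero    f 1≤f = ℕP.≤-refl
  Πℕ-positive (suc s) f 1≤f = ℕP.*-mono-≤ (1≤f Fin.zero) (Πℕ-positive s _ (λ i → 1≤f (Fin.suc i)))

  Πℕ-* : ∀ s (f g : Fin s → ℕ) → Πℕ s (λ i → f i * g i) ≡ Πℕ s f * Πℕ s g
  Πℕ-* zero    f g = refl
  Πℕ-* (suc s) f g = trans (cong (f Fin.zero * g Fin.zero *_) (Πℕ-* s _ _))
                           (interchange (f Fin.zero) (g Fin.zero) _ _)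
    where
    open +-*-Solver
    interchange : ∀ a b c d → a * b * (c * d) ≡ a * c * (b * d)
    interchange = solve 4 (λ a b c d → a :* b :* (c :* d) := a :* c :* (b :* d)) refl

  Πℕ-^ : ∀ s M (q : Fin s → ℕ) → Πℕ s (λ i → M ^ q i) ≡ M ^ Σℕ s q
  Πℕ-^ zero    M q = refl
  Πℕ-^ (suc s) M q = trans (cong (M ^ q Fin.zero *_) (Πℕ-^ s M _)) (sym (ℕP.^-distribˡ-+-* M (q Fin.zero) _))

  factor-≤-Πℕ : ∀ s (f : Fin s → ℕ) → (∀ i → 1 ≤ f i) → ∀ j → f j ≤ Πℕ s f
  factor-≤-Πℕ (suc s) f 1≤f Fin.zero    = ℕP.m≤m*n (f Fin.zero) _
    {{>-nonZero (Πℕ-positive s _ (λ i → 1≤f (Fin.suc i)))}}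
  factor-≤-Πℕ (suc s) f 1≤f (Fin.suc j) = ℕP.≤-trans (factor-≤-Πℕ s _ (λ i → 1≤f (Fin.suc i)) j)
    (ℕP.m≤n*m _ (f Fin.zero) {{>-nonZero (1≤f Fin.zero)}})

  factor-∣-Πℕ : ∀ s (f : Fin s → ℕ) j → f j ∣ Πℕ s f
  factor-∣-Πℕ (suc s) f Fin.zero    = m∣m*n _
  factor-∣-Πℕ (suc s) f (Fin.suc j) = ∣n⇒∣m*n (f Fin.zero) (factor-∣-Πℕ s _ j)

  exponent-bound : ∀ s (a e : Fin s → ℕ) K → (∀ i → 2 ≤ a i) → Πℕ s (λ i → a i ^ e i) < 2 ^ K →
                   ∀ i → e i < K
  exponent-bound s a e K 2≤a x<2ᴷ i = ℕP.≰⇒> λ K≤eᵢ → ℕP.<-irrefl refl (begin-strict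
    2 ^ K                    ≤⟨ ℕP.^-monoʳ-≤ 2 K≤eᵢ ⟩
    2 ^ e i                  ≤⟨ ℕP.^-monoˡ-≤ (e i) (2≤a i) ⟩
    a i ^ e i                ≤⟨ factor-≤-Πℕ s (λ j → a j ^ e j) powers-positive i ⟩
    Πℕ s (λ j → a j ^ e j)   <⟨ x<2ᴷ ⟩
    2 ^ K                    ∎)
    where
    open ℕP.≤-Reasoning
    powers-positive : ∀ j → 1 ≤ a j ^ e j
    powers-positive j = ℕP.m^n>0 (a j) {{>-nonZero (ℕP.≤-trans (s≤s z≤n) (2≤a j))}} (e j)

  length-cartesianProductWith : ∀ (g : ℕ → ℕ → ℕ) xs ys →
    length (cartesianProductWith g xs ys) ≡ length xs * length ys
  length-cartesianProductWith g []       ys = refl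
  length-cartesianProductWith g (x ∷ xs) ys = begin
    length (map (g x) ys ++ cartesianProductWith g xs ys)         ≡⟨ ListP.length-++ (map (g x) ys) ⟩
    length (map (g x) ys) + length (cartesianProductWith g xs ys) ≡⟨ cong₂ _+_ (ListP.length-map (g x) ys)
                                                                               (length-cartesianProductWith g xs ys) ⟩
    length ys + length xs * length ys                             ∎
    where open ≡-Reasoning

  grid : (s : ℕ) → (Fin s → ℕ → ℕ) → (Fin s → ℕ) → List ℕ
  grid zero    f L = 1 ∷ []
  grid (suc s) f L = cartesianProductWith _*_ (applyUpTo (f Fin.zero) (L Fin.zero))
                                              (grid s (λ i → f (Fin.suc i)) (λ i → L (Fin.suc i)))

  length-grid : ∀ s f L → length (grid s f L) ≡ Πℕ s L
  length-grid zero    f L = refl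
  length-grid (suc s) f L = trans (length-cartesianProductWith _*_ (applyUpTo (f Fin.zero) (L Fin.zero)) _)
    (cong₂ _*_ (ListP.length-applyUpTo (f Fin.zero) (L Fin.zero)) (length-grid s _ _))

  ∈-grid : ∀ s f L (n : Fin s → ℕ) → (∀ i → n i < L i) → Πℕ s (λ i → f i (n i)) ∈ grid s f L
  ∈-grid zero    f L n n<L = here refl
  ∈-grid (suc s) f L n n<L = ∈-cartesianProductWith⁺ _*_ (∈-applyUpTo⁺ (f Fin.zero) (n<L Fin.zero))
                               (∈-grid s _ _ (λ i → n (Fin.suc i)) (λ i → n<L (Fin.suc i)))

module NaturalRationals where

  open import Data.Nat as ℕ using (ℕ; zero; suc; z≤n)
  import Data.Nat.Properties as ℕP
  import Data.Nat.Coprimality as Coprime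
  open import Data.Integer as ℤ using (+_)
  import Data.Integer.Properties as ℤP
  open import Data.Rational as ℚ using (ℚ; mkℚ; 0ℚ; 1ℚ; _+_; _*_; _≤_; _<_)
  import Data.Rational.Properties as ℚP
  open import Data.Fin as Fin using (Fin; fromℕ; inject₁)
  open import Relation.Binary.PropositionalEquality
  open import Defs
  open FiniteProducts using (Σℕ)

  natℚ-canonical : ∀ n → natℚ n ≡ mkℚ (+ n) 0 (Coprime.sym (Coprime.1-coprimeTo n))
  natℚ-canonical n = ℚP.normalize-coprime (Coprime.sym (Coprime.1-coprimeTo n))

  natℚ-+ : ∀ m n → natℚ (m ℕ.+ n) ≡ natℚ m + natℚ n
  natℚ-+ m n rewrite natℚ-canonical m | natℚ-canonical n =
    ℚP./-cong (cong₂ ℤ._+_ (sym (ℤP.*-identityʳ (+ m))) (sym (ℤP.*-identityʳ (+ n)))) refl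

  natℚ-* : ∀ m n → natℚ (m ℕ.* n) ≡ natℚ m * natℚ n
  natℚ-* m n rewrite natℚ-canonical m | natℚ-canonical n = ℚP./-cong (ℤP.pos-* m n) refl

  natℚ-mono-≤ : ∀ {m n} → m ℕ.≤ n → natℚ m ≤ natℚ n
  natℚ-mono-≤ {m} {n} m≤n rewrite natℚ-canonical m | natℚ-canonical n =
    ℚ.*≤* (ℤP.*-monoʳ-≤-nonNeg (+ 1) (ℤ.+≤+ m≤n))

  natℚ-cancel-≤ : ∀ {m n} → natℚ m ≤ natℚ n → m ℕ.≤ n
  natℚ-cancel-≤ {m} {n} le rewrite natℚ-canonical m | natℚ-canonical n with le
  ... | ℚ.*≤* m≤n with subst₂ ℤ._≤_ (ℤP.*-identityʳ (+ m)) (ℤP.*-identityʳ (+ n)) m≤n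
  ...   | ℤ.+≤+ m≤n′ = m≤n′

  natℚ-cancel-< : ∀ {m n} → natℚ m < natℚ n → m ℕ.< n
  natℚ-cancel-< {m} {n} lt rewrite natℚ-canonical m | natℚ-canonical n with lt
  ... | ℚ.*<* m<n with subst₂ ℤ._<_ (ℤP.*-identityʳ (+ m)) (ℤP.*-identityʳ (+ n)) m<n
  ...   | ℤ.+<+ m<n′ = m<n′

  natℚ-injective : ∀ {m n} → natℚ m ≡ natℚ n → m ≡ n
  natℚ-injective eq = ℕP.≤-antisym (natℚ-cancel-≤ (ℚP.≤-reflexive eq)) (natℚ-cancel-≤ (ℚP.≤-reflexive (sym eq)))

  natℚ-nonNeg : ∀ n → 0ℚ ≤ natℚ n
  natℚ-nonNeg n = natℚ-mono-≤ {0} {n} z≤n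

  natℚ-NonNegative : ∀ n → ℚ.NonNegative (natℚ n)
  natℚ-NonNegative n = ℚ.nonNegative (natℚ-nonNeg n)

  powℚ-natℚ : ∀ x k → powℚ (natℚ x) k ≡ natℚ (x ℕ.^ k)
  powℚ-natℚ x zero    = refl
  powℚ-natℚ x (suc k) = trans (cong (natℚ x *_) (powℚ-natℚ x k)) (sym (natℚ-* x (x ℕ.^ k)))

  powℚ-natℚ-nonNeg : ∀ x k → 0ℚ ≤ powℚ (natℚ x) k
  powℚ-natℚ-nonNeg x k = subst (0ℚ ≤_) (sym (powℚ-natℚ x k)) (natℚ-nonNeg (x ℕ.^ k))

  Σℚ-cong : ∀ n {f g : Fin n → ℚ} → (∀ i → f i ≡ g i) → Σℚ n f ≡ Σℚ n g
  Σℚ-cong zero    f≗g = refl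
  Σℚ-cong (suc n) f≗g = cong₂ _+_ (f≗g Fin.zero) (Σℚ-cong n (λ i → f≗g (Fin.suc i)))

  Σℚ-natℚ : ∀ n (f : Fin n → ℕ) → Σℚ n (λ i → natℚ (f i)) ≡ natℚ (Σℕ n f)
  Σℚ-natℚ zero    f = refl
  Σℚ-natℚ (suc n) f = trans (cong (λ t → natℚ (f Fin.zero) + t) (Σℚ-natℚ n (λ i → f (Fin.suc i))))
                            (sym (natℚ-+ (f Fin.zero) _))

  Σℚ-scale : ∀ n r (f : Fin n → ℚ) → r * Σℚ n f ≡ Σℚ n (λ i → r * f i)
  Σℚ-scale zero    r f = ℚP.*-zeroʳ r
  Σℚ-scale (suc n) r f = trans (ℚP.*-distribˡ-+ r (f Fin.zero) _)
                               (cong (λ t → r * f Fin.zero + t) (Σℚ-scale n r (λ i → f (Fin.suc i))))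

  Σℚ-init-last : ∀ n (f : Fin (suc n) → ℚ) → Σℚ (suc n) f ≡ Σℚ n (λ i → f (inject₁ i)) + f (fromℕ n)
  Σℚ-init-last zero    f = trans (ℚP.+-identityʳ (f Fin.zero)) (sym (ℚP.+-identityˡ (f Fin.zero)))
  Σℚ-init-last (suc n) f = trans (cong (λ t → f Fin.zero + t) (Σℚ-init-last n (λ i → f (Fin.suc i))))
                                 (sym (ℚP.+-assoc (f Fin.zero) _ _))

  Σℚ-abs-bound : ∀ n (f : Fin n → ℚ) (b : Fin n → ℕ) w →
                 (∀ i → ℚ.∣ f i ∣ ≤ natℚ (b i) * w) → ℚ.∣ Σℚ n f ∣ ≤ natℚ (Σℕ n b) * w
  Σℚ-abs-bound zero    f b w bound = ℚP.≤-reflexive (sym (ℚP.*-zeroˡ w))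
  Σℚ-abs-bound (suc n) f b w bound = begin
    ℚ.∣ f₀ + Σℚ n f′ ∣                     ≤⟨ ℚP.∣p+q∣≤∣p∣+∣q∣ f₀ (Σℚ n f′) ⟩
    ℚ.∣ f₀ ∣ + ℚ.∣ Σℚ n f′ ∣               ≤⟨ ℚP.+-mono-≤ (bound Fin.zero)
                                                (Σℚ-abs-bound n f′ b′ w (λ i → bound (Fin.suc i))) ⟩
    natℚ b₀ * w + natℚ (Σℕ n b′) * w       ≡⟨ sym (ℚP.*-distribʳ-+ w (natℚ b₀) _) ⟩
    (natℚ b₀ + natℚ (Σℕ n b′)) * w         ≡⟨ cong (_* w) (sym (natℚ-+ b₀ _)) ⟩
    natℚ (b₀ ℕ.+ Σℕ n b′) * w              ∎
    where
    open ℚP.≤-Reasoning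
    f₀ : ℚ
    f₀ = f Fin.zero
    b₀ : ℕ
    b₀ = b Fin.zero
    f′ : Fin n → ℚ
    f′ i = f (Fin.suc i)
    b′ : Fin n → ℕ
    b′ i = b (Fin.suc i)

  natℚ-positive : ∀ n → ℚ.Positive (natℚ (suc n))
  natℚ-positive n = subst ℚ.Positive (sym (natℚ-canonical (suc n))) _

  natℚ*inv : ∀ d → natℚ (suc d) * inv (suc d) ≡ 1ℚ
  natℚ*inv d = begin
    natℚ (suc d) * inv (suc d)  ≡⟨ cong₂ _*_ (natℚ-canonical (suc d))
                                             (ℚP.normalize-coprime (Coprime.1-coprimeTo (suc d))) ⟩
    n * ℚ.1/ n                  ≡⟨ ℚP.*-inverseʳ n ⟩
    1ℚ                          ∎
    where
    open ≡-Reasoning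
    n : ℚ
    n = mkℚ (+ suc d) 0 (Coprime.sym (Coprime.1-coprimeTo (suc d)))

module PolynomialGrowth where

  open import Data.Nat as ℕ using (ℕ; zero; suc; z≤n; s≤s)
  import Data.Nat.Properties as ℕP
  import Data.Nat.Solver as ℕSolver
  open import Data.Integer as ℤ using (+_)
  import Data.Integer.Properties as ℤP
  open import Data.Rational as ℚ using (ℚ; mkℚ; 0ℚ; 1ℚ; _+_; _-_; _*_; _≤_)
  import Data.Rational.Properties as ℚP
  open import Data.Rational.Solver using (module +-*-Solver)
  open import Data.Fin using (Fin; toℕ; fromℕ; inject₁)
  import Data.Fin.Properties as FP
  open import Data.Product using (∃; _,_; proj₁; proj₂)
  open import Relation.Nullary using (yes; no)
  open import Relation.Binary.PropositionalEquality
  open import Defs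
  open FiniteProducts using (Σℕ)
  open NaturalRationals

  abs-bound : ∀ q → ∃ λ b → ℚ.∣ q ∣ ≤ natℚ b
  abs-bound q@(mkℚ n d-1 _) = ℤ.∣ n ∣ , subst (ℚ.∣ q ∣ ≤_) (sym (natℚ-canonical ℤ.∣ n ∣))
    (ℚ.*≤* (subst₂ ℤ._≤_ (sym (ℤP.*-identityʳ (+ ℤ.∣ n ∣))) (ℤP.pos-* ℤ.∣ n ∣ (suc d-1))
       (ℤ.+≤+ (ℕP.m≤m*n ℤ.∣ n ∣ (suc d-1)))))

  monomial-bound : ∀ c b x j k → ℚ.∣ c ∣ ≤ natℚ b → 1 ℕ.≤ x → j ℕ.≤ k →
                   ℚ.∣ c * powℚ (natℚ x) j ∣ ≤ natℚ b * powℚ (natℚ x) k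
  monomial-bound c b x j k ∣c∣≤b 1≤x j≤k rewrite powℚ-natℚ x j | powℚ-natℚ x k = begin
    ℚ.∣ c * natℚ (x ℕ.^ j) ∣            ≡⟨ ℚP.∣p*q∣≡∣p∣*∣q∣ c _ ⟩
    ℚ.∣ c ∣ * ℚ.∣ natℚ (x ℕ.^ j) ∣      ≡⟨ cong (ℚ.∣ c ∣ *_) (ℚP.0≤p⇒∣p∣≡p (natℚ-nonNeg (x ℕ.^ j))) ⟩
    ℚ.∣ c ∣ * natℚ (x ℕ.^ j)            ≤⟨ ℚP.*-monoʳ-≤-nonNeg (natℚ (x ℕ.^ j)) {{natℚ-NonNegative (x ℕ.^ j)}} ∣c∣≤b ⟩
    natℚ b * natℚ (x ℕ.^ j)             ≤⟨ ℚP.*-monoˡ-≤-nonNeg (natℚ b) {{natℚ-NonNegative b}} (natℚ-mono-≤ xʲ≤xᵏ) ⟩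
    natℚ b * natℚ (x ℕ.^ k)             ∎
    where
    open ℚP.≤-Reasoning
    xʲ≤xᵏ : x ℕ.^ j ℕ.≤ x ℕ.^ k
    xʲ≤xᵏ = ℕP.^-monoʳ-≤ x {{ℕ.>-nonZero 1≤x}} j≤k

  lower-order-bound : ∀ k (c : Fin (suc k) → ℚ) → ∃ λ B → ∀ x → 1 ℕ.≤ x →
    ℚ.∣ Σℚ (suc k) (λ j → c j * powℚ (natℚ x) (toℕ j)) ∣ ≤ natℚ B * powℚ (natℚ x) k
  lower-order-bound k c = Σℕ (suc k) b , λ x 1≤x →
    Σℚ-abs-bound (suc k) _ b _ λ j →
      monomial-bound (c j) (b j) x (toℕ j) k (proj₂ (abs-bound (c j))) 1≤x (FP.toℕ≤pred[n] j)
    where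
    b : Fin (suc k) → ℕ
    b j = proj₁ (abs-bound (c j))

  split-leading : ∀ k (g : Fin (suc (suc k)) → ℚ) X →
    Σℚ (suc (suc k)) (λ j → g j * powℚ X (toℕ j))
      ≡ Σℚ (suc k) (λ j → g (inject₁ j) * powℚ X (toℕ j)) + g (fromℕ (suc k)) * powℚ X (suc k)
  split-leading k g X = trans (Σℚ-init-last (suc k) (λ j → g j * powℚ X (toℕ j)))
    (cong₂ _+_ (Σℚ-cong (suc k) λ j → cong (λ t → g (inject₁ j) * powℚ X t) (FP.toℕ-inject₁ j))
               (cong (λ t → g (fromℕ (suc k)) * powℚ X t) (FP.toℕ-fromℕ (suc k))))

  leading-term-bound : ∀ v r L Y → 0ℚ ≤ Y → v ≡ r + L * Y → ℚ.∣ L ∣ * Y ≤ ℚ.∣ v ∣ + ℚ.∣ r ∣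
  leading-term-bound v r L Y 0≤Y v≡r+LY = begin
    ℚ.∣ L ∣ * Y          ≡⟨ cong (ℚ.∣ L ∣ *_) (sym (ℚP.0≤p⇒∣p∣≡p 0≤Y)) ⟩
    ℚ.∣ L ∣ * ℚ.∣ Y ∣    ≡⟨ sym (ℚP.∣p*q∣≡∣p∣*∣q∣ L Y) ⟩
    ℚ.∣ L * Y ∣          ≡⟨ cong ℚ.∣_∣ LY≡v-r ⟩
    ℚ.∣ v - r ∣          ≤⟨ ℚP.∣p-q∣≤∣p∣+∣q∣ v r ⟩
    ℚ.∣ v ∣ + ℚ.∣ r ∣    ∎
    where
    open ℚP.≤-Reasoning
    open +-*-Solver
    LY≡v-r : L * Y ≡ v - r
    LY≡v-r = trans (solve 2 (λ r t → t := (r :+ t) :- r) refl r (L * Y)) (cong (_- r) (sym v≡r+LY))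

  reciprocal-bound : ∀ L .{{_ : ℚ.NonZero L}} b → ℚ.∣ ℚ.1/ L ∣ ≤ natℚ b → 1ℚ ≤ natℚ b * ℚ.∣ L ∣
  reciprocal-bound L b ∣1/L∣≤b = begin
    1ℚ                       ≡⟨ cong ℚ.∣_∣ (sym (ℚP.*-inverseˡ L)) ⟩
    ℚ.∣ ℚ.1/ L * L ∣         ≡⟨ ℚP.∣p*q∣≡∣p∣*∣q∣ (ℚ.1/ L) L ⟩
    ℚ.∣ ℚ.1/ L ∣ * ℚ.∣ L ∣   ≤⟨ ℚP.*-monoʳ-≤-nonNeg ℚ.∣ L ∣ {{ℚ.nonNegative (ℚP.0≤∣p∣ L)}} ∣1/L∣≤b ⟩
    natℚ b * ℚ.∣ L ∣         ∎
    where open ℚP.≤-Reasoning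

  leading-bound : ∀ {L X E β} → 1ℚ ≤ β * ℚ.∣ L ∣ → 0ℚ ≤ X → 0ℚ ≤ β → ℚ.∣ L ∣ * X ≤ E → X ≤ β * E
  leading-bound {L} {X} {E} {β} 1≤β∣L∣ 0≤X 0≤β ∣L∣X≤E = begin
    X                      ≡⟨ sym (ℚP.*-identityˡ X) ⟩
    1ℚ * X                 ≤⟨ ℚP.*-monoʳ-≤-nonNeg X {{ℚ.nonNegative 0≤X}} 1≤β∣L∣ ⟩
    β * ℚ.∣ L ∣ * X        ≡⟨ ℚP.*-assoc β _ X ⟩
    β * (ℚ.∣ L ∣ * X)      ≤⟨ ℚP.*-monoˡ-≤-nonNeg β {{ℚ.nonNegative 0≤β}} ∣L∣X≤E ⟩
    β * E                  ∎
    where open ℚP.≤-Reasoning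

  absorb : ∀ {y u C z} → y ℕ.≤ u ℕ.+ C ℕ.* z → 2 ℕ.* C ℕ.* z ℕ.≤ y → y ℕ.≤ 2 ℕ.* u
  absorb {y} {u} {C} {z} y≤u+Cz 2Cz≤y = ℕP.+-cancelʳ-≤ y y (2 ℕ.* u) (begin
    y ℕ.+ y                                   ≤⟨ ℕP.+-mono-≤ y≤u+Cz y≤u+Cz ⟩
    (u ℕ.+ C ℕ.* z) ℕ.+ (u ℕ.+ C ℕ.* z)       ≡⟨ solve 3 (λ u C z → (u :+ C :* z) :+ (u :+ C :* z)
                                                            := con 2 :* u :+ con 2 :* C :* z) refl u C z ⟩
    2 ℕ.* u ℕ.+ 2 ℕ.* C ℕ.* z                 ≤⟨ ℕP.+-monoʳ-≤ (2 ℕ.* u) 2Cz≤y ⟩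
    2 ℕ.* u ℕ.+ y                             ∎)
    where
    open ℕP.≤-Reasoning
    open ℕSolver.+-*-Solver

  -- For P of degree d = k + 1 with leading coefficient L ≠ 0 there are b, B with
  -- xᵈ ≤ b·P(x) + b·B·x^{d-1} whenever x ≥ 1 and P(x) ∈ ℕ: write
  -- P(x) = (lower part) + L·xᵈ, so |L|·xᵈ ≤ P(x) + B·x^{d-1}, and take b ≥ 1/|L|.
  leading-term-dominates : ∀ k (g : Fin (suc (suc k)) → ℚ) → g (fromℕ (suc k)) ≢ 0ℚ →
    ∃ λ b → ∃ λ B → ∀ x e → 1 ℕ.≤ x → Σℚ (suc (suc k)) (λ j → g j * powℚ (natℚ x) (toℕ j)) ≡ natℚ e →
      x ℕ.^ suc k ℕ.≤ b ℕ.* e ℕ.+ b ℕ.* B ℕ.* x ℕ.^ k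
  leading-term-dominates k g L≢0 = b , B , dominated
    where
    L : ℚ
    L = g (fromℕ (suc k))
    instance L-nonZero : ℚ.NonZero L
    L-nonZero = ℚ.≢-nonZero L≢0
    b : ℕ
    b = proj₁ (abs-bound (ℚ.1/ L))
    B : ℕ
    B = proj₁ (lower-order-bound k (λ j → g (inject₁ j)))
    dominated : ∀ x e → 1 ℕ.≤ x → Σℚ (suc (suc k)) (λ j → g j * powℚ (natℚ x) (toℕ j)) ≡ natℚ e →
                x ℕ.^ suc k ℕ.≤ b ℕ.* e ℕ.+ b ℕ.* B ℕ.* x ℕ.^ k
    dominated x e 1≤x Px≡e = natℚ-cancel-≤ (subst₂ _≤_ (powℚ-natℚ x (suc k)) back-to-ℕ
      (leading-bound (reciprocal-bound L b (proj₂ (abs-bound (ℚ.1/ L)))) (powℚ-natℚ-nonNeg x (suc k))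
                     (natℚ-nonNeg b) ∣L∣Xᵈ≤e+BXᵏ))
      where
      X : ℚ
      X = natℚ x
      lower : ℚ
      lower = Σℚ (suc k) (λ j → g (inject₁ j) * powℚ X (toℕ j))
      ∣L∣Xᵈ≤e+BXᵏ : ℚ.∣ L ∣ * powℚ X (suc k) ≤ natℚ e + natℚ B * powℚ X k
      ∣L∣Xᵈ≤e+BXᵏ = begin
        ℚ.∣ L ∣ * powℚ X (suc k)   ≤⟨ leading-term-bound (natℚ e) lower L _ (powℚ-natℚ-nonNeg x (suc k))
                                                         (trans (sym Px≡e) (split-leading k g X)) ⟩
        ℚ.∣ natℚ e ∣ + ℚ.∣ lower ∣ ≤⟨ ℚP.+-mono-≤ (ℚP.≤-reflexive (ℚP.0≤p⇒∣p∣≡p (natℚ-nonNeg e)))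
                                                  (proj₂ (lower-order-bound k (λ j → g (inject₁ j))) x 1≤x) ⟩
        natℚ e + natℚ B * powℚ X k ∎
        where open ℚP.≤-Reasoning
      back-to-ℕ : natℚ b * (natℚ e + natℚ B * powℚ X k) ≡ natℚ (b ℕ.* e ℕ.+ b ℕ.* B ℕ.* x ℕ.^ k)
      back-to-ℕ = begin
        natℚ b * (natℚ e + natℚ B * powℚ X k)       ≡⟨ cong (λ t → natℚ b * (natℚ e + natℚ B * t)) (powℚ-natℚ x k) ⟩
        natℚ b * (natℚ e + natℚ B * natℚ (x ℕ.^ k)) ≡⟨ cong (λ t → natℚ b * (natℚ e + t)) (natℚ-* B _) ⟨
        natℚ b * (natℚ e + natℚ (B ℕ.* x ℕ.^ k))    ≡⟨ cong (natℚ b *_) (natℚ-+ e _) ⟨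
        natℚ b * natℚ (e ℕ.+ B ℕ.* x ℕ.^ k)         ≡⟨ natℚ-* b _ ⟨
        natℚ (b ℕ.* (e ℕ.+ B ℕ.* x ℕ.^ k))          ≡⟨ cong natℚ (ℕP.*-distribˡ-+ b e _) ⟩
        natℚ (b ℕ.* e ℕ.+ b ℕ.* (B ℕ.* x ℕ.^ k))    ≡⟨ cong (λ t → natℚ (b ℕ.* e ℕ.+ t)) (ℕP.*-assoc b B _) ⟨
        natℚ (b ℕ.* e ℕ.+ b ℕ.* B ℕ.* x ℕ.^ k)      ∎
        where open ≡-Reasoning

  -- Growth of polynomials: for deg P = d ≥ 1, xᵈ ≤ c·P(x) for all large x with
  -- P(x) ∈ ℕ; the lower-order term is absorbed once x ≥ 2·b·B.
  growth : (P : Poly) → 1 ℕ.≤ deg P →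
           ∃ λ c → ∃ λ n₀ → ∀ x e → n₀ ℕ.≤ x → eval P x ≡ natℚ e → x ℕ.^ deg P ℕ.≤ c ℕ.* e
  growth record { deg = suc k ; coeff = g ; leading = L≢0 } _ = 2 ℕ.* b , suc (2 ℕ.* (b ℕ.* B)) , grows
    where
    dominance : ∃ λ b → ∃ λ B → ∀ x e → 1 ℕ.≤ x → Σℚ (suc (suc k)) (λ j → g j * powℚ (natℚ x) (toℕ j)) ≡ natℚ e →
                  x ℕ.^ suc k ℕ.≤ b ℕ.* e ℕ.+ b ℕ.* B ℕ.* x ℕ.^ k
    dominance = leading-term-dominates k g L≢0
    b : ℕ
    b = proj₁ dominance
    B : ℕ
    B = proj₁ (proj₂ dominance)
    grows : ∀ x e → suc (2 ℕ.* (b ℕ.* B)) ℕ.≤ x → Σℚ (suc (suc k)) (λ j → g j * powℚ (natℚ x) (toℕ j)) ≡ natℚ e →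
            x ℕ.^ suc k ℕ.≤ 2 ℕ.* b ℕ.* e
    grows x e n₀≤x Px≡e = subst (x ℕ.^ suc k ℕ.≤_) (sym (ℕP.*-assoc 2 b e))
      (absorb {u = b ℕ.* e} {C = b ℕ.* B} {z = x ℕ.^ k}
        (proj₂ (proj₂ dominance) x e (ℕP.≤-trans (s≤s z≤n) n₀≤x) Px≡e)
        (ℕP.*-monoˡ-≤ (x ℕ.^ k) (ℕP.≤-trans (ℕP.n≤1+n _) n₀≤x)))

  *-^-≤ : ∀ c t d → c ℕ.* t ℕ.^ suc d ℕ.≤ (c ℕ.* t) ℕ.^ suc d
  *-^-≤ zero    t d = z≤n
  *-^-≤ (suc c) t d = begin
    suc c ℕ.* (t ℕ.* t ℕ.^ d)     ≡⟨ ℕP.*-assoc (suc c) t _ ⟨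
    suc c ℕ.* t ℕ.* t ℕ.^ d       ≤⟨ ℕP.*-monoʳ-≤ (suc c ℕ.* t) (ℕP.^-monoˡ-≤ d (ℕP.m≤n*m t (suc c))) ⟩
    suc c ℕ.* t ℕ.* (suc c ℕ.* t) ℕ.^ d ∎
    where open ℕP.≤-Reasoning

  root-bound : ∀ {d n c e t} → 1 ℕ.≤ d → n ℕ.^ d ℕ.≤ c ℕ.* e → e ℕ.< t ℕ.^ d → n ℕ.≤ c ℕ.* t
  root-bound {suc d} {n} {c} {e} {t} _ nᵈ≤ce e<tᵈ = ℕP.≮⇒≥ λ ct<n → ℕP.<-irrefl refl (begin-strict
    (c ℕ.* t) ℕ.^ suc d   <⟨ ℕP.^-monoˡ-< (suc d) ct<n ⟩
    n ℕ.^ suc d           ≤⟨ nᵈ≤ce ⟩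
    c ℕ.* e               ≤⟨ ℕP.*-monoʳ-≤ c (ℕP.<⇒≤ e<tᵈ) ⟩
    c ℕ.* t ℕ.^ suc d     ≤⟨ *-^-≤ c t d ⟩
    (c ℕ.* t) ℕ.^ suc d   ∎)
    where open ℕP.≤-Reasoning

  -- Arguments with small values: there is C such that P(n) < tᵈ implies n < C·t
  -- (for t ≥ 1); small n are absorbed into C, large n are handled by growth.
  preimage-bound : (P : Poly) → 1 ℕ.≤ deg P →
    ∃ λ C → ∀ t n e → 1 ℕ.≤ t → eval P n ≡ natℚ e → e ℕ.< t ℕ.^ deg P → n ℕ.< C ℕ.* t
  preimage-bound P 1≤d with growth P 1≤d
  ... | c , n₀ , grows = suc (n₀ ℕ.+ c) , bound
    where
    open ℕSolver.+-*-Solver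
    bound : ∀ t n e → 1 ℕ.≤ t → eval P n ≡ natℚ e → e ℕ.< t ℕ.^ deg P → n ℕ.< suc (n₀ ℕ.+ c) ℕ.* t
    bound t n e 1≤t Pn≡e e<tᵈ = begin-strict
      n                                     ≤⟨ n≤n₀+ct ⟩
      n₀ ℕ.+ c ℕ.* t                        <⟨ ℕP.n<1+n _ ⟩
      1 ℕ.+ (n₀ ℕ.+ c ℕ.* t)                ≤⟨ ℕP.+-mono-≤ 1≤t
                                                 (ℕP.+-monoˡ-≤ (c ℕ.* t) (ℕP.m≤m*n n₀ t {{ℕ.>-nonZero 1≤t}})) ⟩
      t ℕ.+ (n₀ ℕ.* t ℕ.+ c ℕ.* t)          ≡⟨ solve 3 (λ t n₀ c → t :+ (n₀ :* t :+ c :* t)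
                                                              := (con 1 :+ (n₀ :+ c)) :* t) refl t n₀ c ⟩
      suc (n₀ ℕ.+ c) ℕ.* t                  ∎
      where
      open ℕP.≤-Reasoning
      n≤n₀+ct : n ℕ.≤ n₀ ℕ.+ c ℕ.* t
      n≤n₀+ct with n ℕP.<? n₀
      ... | yes n<n₀ = ℕP.≤-trans (ℕP.<⇒≤ n<n₀) (ℕP.m≤m+n n₀ _)
      ... | no  n≮n₀ = ℕP.≤-trans (root-bound {c = c} 1≤d (grows n e (ℕP.≮⇒≥ n≮n₀) Pn≡e) e<tᵈ) (ℕP.m≤n+m _ n₀)

module DegreeBudget where

  open import Data.Nat as ℕ using (ℕ; suc)
  import Data.Nat.Properties as ℕP
  open import Data.Nat.Divisibility using (_∣_)
  open import Data.Rational using (1ℚ; _*_; _<_)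
  import Data.Rational.Properties as ℚP
  open import Data.Fin using (Fin)
  open import Data.Product using (∃; _×_; _,_)
  open import Relation.Binary.PropositionalEquality
  open import Defs
  open FiniteProducts using (Σℕ; Πℕ-positive; factor-∣-Πℕ)
  open NaturalRationals

  degree-budget : ∀ s (d q : Fin s → ℕ) D → (∀ i → 1 ℕ.≤ d i) → (∀ i → q i ℕ.* d i ≡ suc D) →
                  Σℚ s (λ i → inv (d i)) < 1ℚ → Σℕ s q ℕ.< suc D
  degree-budget s d q D 1≤d qd≡D Σ<1 = natℚ-cancel-< (begin-strict
    natℚ (Σℕ s q)                        ≡⟨ Σℚ-natℚ s q ⟨
    Σℚ s (λ i → natℚ (q i))              ≡⟨ Σℚ-cong s scaled-inverse ⟨
    Σℚ s (λ i → natℚ (suc D) * inv (d i)) ≡⟨ Σℚ-scale s (natℚ (suc D)) _ ⟨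
    natℚ (suc D) * Σℚ s (λ i → inv (d i)) <⟨ ℚP.*-monoʳ-<-pos (natℚ (suc D)) {{natℚ-positive D}} Σ<1 ⟩
    natℚ (suc D) * 1ℚ                    ≡⟨ ℚP.*-identityʳ _ ⟩
    natℚ (suc D)                         ∎)
    where
    open ℚP.≤-Reasoning
    scaled-inverse : ∀ i → natℚ (suc D) * inv (d i) ≡ natℚ (q i)
    scaled-inverse i with d i | 1≤d i | qd≡D i
    ... | suc d′ | _ | qd≡D′ = begin-equality
      natℚ (suc D) * inv (suc d′)                     ≡⟨ cong (λ n → natℚ n * inv (suc d′)) (sym qd≡D′) ⟩
      natℚ (q i ℕ.* suc d′) * inv (suc d′)            ≡⟨ cong (_* inv (suc d′)) (natℚ-* (q i) (suc d′)) ⟩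
      natℚ (q i) * natℚ (suc d′) * inv (suc d′)       ≡⟨ ℚP.*-assoc (natℚ (q i)) _ _ ⟩
      natℚ (q i) * (natℚ (suc d′) * inv (suc d′))     ≡⟨ cong (natℚ (q i) *_) (natℚ*inv d′) ⟩
      natℚ (q i) * 1ℚ                                 ≡⟨ ℚP.*-identityʳ _ ⟩
      natℚ (q i)                                      ∎

  -- The exponents of the argument: with D = ∏ dᵢ = D′ + 1 and qᵢ = D / dᵢ,
  -- Σ 1/dᵢ < 1 gives Σ qᵢ ≤ D′.
  exponent-budget : ∀ s (d : Fin s → ℕ) → (∀ i → 1 ℕ.≤ d i) → Σℚ s (λ i → inv (d i)) < 1ℚ →
    ∃ λ D′ → ∃ λ (q : Fin s → ℕ) → (∀ i → q i ℕ.* d i ≡ suc D′) × Σℕ s q ℕ.≤ D′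
  exponent-budget s d 1≤d Σ<1 = D′ , q , qd≡D , ℕP.≤-pred (degree-budget s d q D′ 1≤d qd≡D Σ<1)
    where
    D′ : ℕ
    D′ = ℕ.pred (Πℕ s d)
    D≡ : suc D′ ≡ Πℕ s d
    D≡ = ℕP.suc-pred (Πℕ s d) {{ℕ.>-nonZero (Πℕ-positive s d 1≤d)}}
    q : Fin s → ℕ
    q i = _∣_.quotient (factor-∣-Πℕ s d i)
    qd≡D : ∀ i → q i ℕ.* d i ≡ suc D′
    qd≡D i = trans (sym (_∣_.equality (factor-∣-Πℕ s d i))) (sym D≡)

module Room where

  open import Data.Nat using (ℕ; zero; suc; z≤n; s≤s; _+_; _*_; _^_; _<_)
  import Data.Nat.Properties as ℕP
  import Data.Nat.Solver as ℕSolver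
  open import Relation.Binary.PropositionalEquality

  n<2^n : ∀ n → n < 2 ^ n
  n<2^n zero    = s≤s z≤n
  n<2^n (suc n) = ℕP.+-mono-≤-< (ℕP.m^n>0 2 n) (ℕP.<-≤-trans (n<2^n n) (ℕP.m≤m+n (2 ^ n) 0))

  room-above-power : ∀ N Z → N + 2 ^ Z < 2 ^ (Z + suc N)
  room-above-power N Z = begin-strict
    N + 2 ^ Z                    <⟨ ℕP.+-monoˡ-< (2 ^ Z) (ℕP.n<1+n N) ⟩
    suc N + 2 ^ Z                ≤⟨ ℕP.+-monoˡ-≤ (2 ^ Z) (ℕP.m≤n*m (suc N) (2 ^ Z) {{ℕP.m^n≢0 2 Z}}) ⟩
    2 ^ Z * suc N + 2 ^ Z        ≡⟨ solve 2 (λ x n → x :* (con 1 :+ n) :+ x := x :* (con 1 :+ (con 1 :+ n)))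
                                          refl (2 ^ Z) N ⟩
    2 ^ Z * suc (suc N)          ≤⟨ ℕP.*-monoʳ-≤ (2 ^ Z) (n<2^n (suc N)) ⟩
    2 ^ Z * 2 ^ suc N            ≡⟨ ℕP.^-distribˡ-+-* 2 Z (suc N) ⟨
    2 ^ (Z + suc N)              ∎
    where
    open ℕP.≤-Reasoning
    open ℕSolver.+-*-Solver

  -- The numerical heart of the argument: with M = N + 1 + C,
  -- N + 2^{C·M^{D′}} < 2^{M^{D′+1}}, because C·M^{D′} + N + 1 ≤ M^{D′+1}.
  room : ∀ C N D′ → N + 2 ^ (C * (suc N + C) ^ D′) < 2 ^ ((suc N + C) ^ suc D′)
  room C N D′ = ℕP.<-≤-trans (room-above-power N (C * W)) (ℕP.^-monoʳ-≤ 2 (begin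
    C * W + suc N                ≤⟨ ℕP.+-monoʳ-≤ (C * W) (ℕP.m≤m*n (suc N) W {{ℕP.m^n≢0 M D′}}) ⟩
    C * W + suc N * W            ≡⟨ ℕP.+-comm (C * W) _ ⟩
    suc N * W + C * W            ≡⟨ ℕP.*-distribʳ-+ W (suc N) C ⟨
    M * W                        ∎))
    where
    open ℕP.≤-Reasoning
    M : ℕ
    M = suc N + C
    W : ℕ
    W = M ^ D′

module PowerProductSets where

  open import Data.Nat using (ℕ; suc; _+_; _*_; _^_; _≤_; _<_; _≥_)
  import Data.Nat.Properties as ℕP
  open import Data.Fin using (Fin)
  open import Data.List using (List; length)
  open import Data.List.Membership.Propositional using (_∈_)
  open import Data.Product using (∃; _×_; _,_; proj₁; proj₂)
  open import Data.Rational using (1ℚ) renaming (_<_ to _<ℚ_)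
  open import Relation.Binary.PropositionalEquality
  open import Defs
  open FiniteProducts
  open NaturalRationals using (natℚ-injective)
  open PolynomialGrowth using (preimage-bound)
  open DegreeBudget using (exponent-budget)
  open Room using (room)

  module _ (s : ℕ) (a : Fin s → ℕ) (a≥2 : (i : Fin s) → a i ≥ 2)
           (P : Fin s → Poly) (P∈𝒫 : (i : Fin s) → InPN (P i)) where

    value : Fin s → ℕ → ℕ
    value i n = proj₁ (InPN.natValued (P∈𝒫 i) n)

    terms : Fin s → ℕ → ℕ
    terms i n = a i ^ value i n

    small-elements-in-grid : ∀ K (bound : Fin s → ℕ) → (∀ i n → value i n < K → n < bound i) →
      ∀ {x} → PowSet s a P x → x < 2 ^ K → x ∈ grid s terms bound
    small-elements-in-grid K bound small {x} (n , e , Pn≡e , x≡) x<2ᴷ =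
      subst (_∈ grid s terms bound) (sym x≡terms) (∈-grid s terms bound n n<bound)
      where
      e≡value : ∀ i → e i ≡ value i (n i)
      e≡value i = natℚ-injective (trans (sym (Pn≡e i)) (proj₂ (InPN.natValued (P∈𝒫 i) (n i))))
      x≡terms : x ≡ Πℕ s (λ i → terms i (n i))
      x≡terms = trans x≡ (Πℕ-cong s (λ i → cong (a i ^_) (e≡value i)))
      n<bound : ∀ i → n i < bound i
      n<bound i = small i (n i) (subst (_< K) (e≡value i) (exponent-bound s a e K a≥2 (subst (_< 2 ^ K) x≡ x<2ᴷ) i))

    -- A is sparse: take D = ∏ dᵢ = D′ + 1, qᵢ = D / dᵢ, M = N + 1 + ∏ Cᵢ and
    -- X = 2^{Mᴰ}; then Pᵢ(n) < Mᴰ = (M^{qᵢ})^{dᵢ} gives n < Cᵢ·M^{qᵢ}, and the grid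
    -- has at most ∏ Cᵢ · M^{Σ qᵢ} ≤ ∏ Cᵢ · M^{D′} elements.
    powSet-sparse : Σℚ s (λ i → inv (deg (P i))) <ℚ 1ℚ →
      ∀ N → ∃ λ X → ∃ λ (L : List ℕ) → N + 2 ^ length L < X × (∀ {x} → PowSet s a P x → x < X → x ∈ L)
    powSet-sparse Σ<1 N = 2 ^ K , grid s terms bound , enough-room , small-elements-in-grid K bound small
      where
      budget : ∃ λ D′ → ∃ λ (q : Fin s → ℕ) → (∀ i → q i * deg (P i) ≡ suc D′) × Σℕ s q ≤ D′
      budget = exponent-budget s (λ i → deg (P i)) (λ i → InPN.nonconst (P∈𝒫 i)) Σ<1
      D′ : ℕ
      D′ = proj₁ budget
      q : Fin s → ℕ
      q = proj₁ (proj₂ budget)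
      qd≡D : ∀ i → q i * deg (P i) ≡ suc D′
      qd≡D = proj₁ (proj₂ (proj₂ budget))
      Σq≤D′ : Σℕ s q ≤ D′
      Σq≤D′ = proj₂ (proj₂ (proj₂ budget))
      C : Fin s → ℕ
      C i = proj₁ (preimage-bound (P i) (InPN.nonconst (P∈𝒫 i)))
      M : ℕ
      M = suc N + Πℕ s C
      K : ℕ
      K = M ^ suc D′
      bound : Fin s → ℕ
      bound i = C i * M ^ q i
      small : ∀ i n → value i n < K → n < bound i
      small i n v<K = proj₂ (preimage-bound (P i) (InPN.nonconst (P∈𝒫 i))) (M ^ q i) n (value i n)
        (ℕP.m^n>0 M (q i)) (proj₂ (InPN.natValued (P∈𝒫 i) n))
        (subst (value i n <_) (trans (cong (M ^_) (sym (qd≡D i))) (sym (ℕP.^-*-assoc M (q i) (deg (P i))))) v<K)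
      grid-size : length (grid s terms bound) ≤ Πℕ s C * M ^ D′
      grid-size = begin
        length (grid s terms bound)          ≡⟨ length-grid s terms bound ⟩
        Πℕ s bound                           ≡⟨ Πℕ-* s C (λ i → M ^ q i) ⟩
        Πℕ s C * Πℕ s (λ i → M ^ q i)        ≡⟨ cong (Πℕ s C *_) (Πℕ-^ s M q) ⟩
        Πℕ s C * M ^ Σℕ s q                  ≤⟨ ℕP.*-monoʳ-≤ (Πℕ s C) (ℕP.^-monoʳ-≤ M Σq≤D′) ⟩
        Πℕ s C * M ^ D′                      ∎
        where open ℕP.≤-Reasoning
      enough-room : N + 2 ^ length (grid s terms bound) < 2 ^ K
      enough-room = ℕP.≤-<-trans (ℕP.+-monoʳ-≤ N (ℕP.^-monoʳ-≤ 2 grid-size)) (room (Πℕ s C) N D′)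

open import Defs
open import Data.Nat using (ℕ; _≥_)
open import Data.Fin using (Fin)
open import Data.Rational using (_<_; 1ℚ)
open import Relation.Nullary using (¬_)
open SubsetSums using (sparse⇒¬complete)
open PowerProductSets using (powSet-sparse)

-- Theorem A1: A is sparse, hence not complete.
theoremA1 : (s : ℕ) → s ≥ 1 → (a : Fin s → ℕ) → ((i : Fin s) → a i ≥ 2) →
    (P : Fin s → Poly) → ((i : Fin s) → InPN (P i)) →
    Σℚ s (λ i → inv (deg (P i))) < 1ℚ →
    ¬ Complete (PowSet s a P)
theoremA1 s _ a a≥2 P P∈𝒫 Σ<1 = sparse⇒¬complete (PowSet s a P) (powSet-sparse s a a≥2 P P∈𝒫 Σ<1)
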